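{- Let $x_{\text{jopt}}$ be the job-optimal relaxed unsplit stable assignment and $x_{\text{mopt}}$ the machine-optimal relaxed unsplit stable assignment of an instance (both exist). Then for every relaxed unsplit stable assignment $x$ of the instance, \[ |x_{\text{mopt}}| \le |x| \le |x_{\text{jopt}}|, \] i.e. among all relaxed unsplit stable assignments, $|x|$ is maximized at $x_{\text{jopt}}$ and minimized at $x_{\text{mopt}}$.
   Context: An instance consists of a finite bipartite graph $G=(J\cup M,E)$ between a set $J$ of jobs and a set $M$ of machines; each job $j$ has a size $q(j)>0$ and each machine $m$ a capacity $q(m)>0$. Every job has a strict preference order over its incident edges (equivalently, adjacent machines) and every machine has a strict preference order over its incident edges (adjacent jobs). $M$ contains a dummy machine $m_d$ that is adjacent to every job, is ranked last by every job, and has capacity $q(m_d)>\sum_{j\in J}q(j)$. An assignment is a function $x:E\to\mathbb{R}_{\ge 0}$; write $x(j)=\sum_{m}x(jm)$ and $x(m)=\sum_j x(jm)$. An assignment is unsplit if $x(jm)\in\{0,q(j)\}$ for all $jm\in E$ and $x(j)\le q(j)$ for every job (so each job is assigned entirely to at most one machine). An unsplit assignment $x$ is a relaxed unsplit assignment if for every machine $m$ to which at least one job is assigned, $x(m)-q(j_m)<q(m)$, where $j_m$ is the job assigned to $m$ that $m$ likes least. A relaxed unsplit assignment $x$ is stable if for every edge $jm$ with $x(jm)=0$, either $j$ is assigned to a machine it prefers to $m$, or $\sum_{j' : m \text{ prefers } j' \text{ to } j} x(j'm)\ge q(m)$. The size is $|x|=\sum_{jm\in E,\, m\neq m_d}x(jm)$.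 Comparisons: for unsplit assignments $x_1,x_2$, a job $j$ weakly prefers $x_1$ to $x_2$ if the machine $j$ is assigned to in $x_1$ is equal to or preferred by $j$ to its machine in $x_2$; a machine $m$ weakly prefers $x_1$ to $x_2$ if either no edge incident to $m$ is positive in exactly one of $x_1,x_2$, or the edge that $m$ ranks best among the edges incident to $m$ that are positive in exactly one of $x_1,x_2$ is positive in $x_1$ (lexicographic order). A relaxed unsplit stable assignment is job-optimal (resp. machine-optimal) if every job (resp. machine) weakly prefers it to every relaxed unsplit stable assignment; it is job-pessimal (resp. machine-pessimal) if every job (resp. machine) weakly prefers every relaxed unsplit stable assignment to it. It is known that a job-optimal relaxed unsplit stable assignment exists.
   Formalization: The job sizes $q(j)$, the machine capacities $q(m)$ and the assignment values are taken in the rationals rather than the reals. -}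

module Defs where

open import Data.Nat as ℕ using (ℕ; zero; suc; _<ᵇ_)
open import Data.Fin using (Fin; zero; suc; _≟_)
open import Data.Bool using (Bool; true; false; if_then_else_)
open import Data.Rational as ℚ using (ℚ; 0ℚ; _+_; _-_)
open import Data.Product using (Σ; ∃; _×_; _,_)
open import Data.Sum using (_⊎_)
open import Relation.Nullary using (¬_; yes; no)
open import Relation.Binary.PropositionalEquality using (_≡_; _≢_)

sumFin : (n : ℕ) → (Fin n → ℚ) → ℚ
sumFin zero    f = 0ℚ
sumFin (suc n) f = f zero + sumFin n (λ i → f (suc i))

-- Jobs are Fin nJ, machines Fin nM.
-- adj j m ≡ true  iff  jm ∈ E.
-- Strict preferences over incident edges are encoded by rank functions
-- (smaller rank = more preferred) that are injective on incident edges.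
record Instance : Set where
  field
    nJ nM   : ℕ
    adj     : Fin nJ → Fin nM → Bool
    qJ      : Fin nJ → ℚ
    qM      : Fin nM → ℚ
    qJ-pos  : ∀ j → 0ℚ ℚ.< qJ j
    qM-pos  : ∀ m → 0ℚ ℚ.< qM m
    rankJ   : Fin nJ → Fin nM → ℕ
    rankJ-inj : ∀ j m m' → adj j m ≡ true → adj j m' ≡ true →
                rankJ j m ≡ rankJ j m' → m ≡ m'
    rankM   : Fin nM → Fin nJ → ℕ
    rankM-inj : ∀ m j j' → adj j m ≡ true → adj j' m ≡ true →
                rankM m j ≡ rankM m j' → j ≡ j'
    md      : Fin nM
    md-adj  : ∀ j → adj j md ≡ true
    md-last : ∀ j m → adj j m ≡ true → m ≢ md → rankJ j m ℕ.< rankJ j md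
    md-cap  : sumFin nJ qJ ℚ.< qM md

module _ (I : Instance) where
  open Instance I

  Assignment : Set
  Assignment = Fin nJ → Fin nM → ℚ

  xJ : Assignment → Fin nJ → ℚ
  xJ x j = sumFin nM (λ m → x j m)

  xM : Assignment → Fin nM → ℚ
  xM x m = sumFin nJ (λ j → x j m)

  Pos : Assignment → Fin nJ → Fin nM → Set
  Pos x j m = 0ℚ ℚ.< x j m

  IsAssignment : Assignment → Set
  IsAssignment x = (∀ j m → 0ℚ ℚ.≤ x j m) × (∀ j m → adj j m ≡ false → x j m ≡ 0ℚ)

  IsUnsplit : Assignment → Set
  IsUnsplit x = IsAssignment x
              × (∀ j m → adj j m ≡ true → (x j m ≡ 0ℚ) ⊎ (x j m ≡ qJ j))
              × (∀ j → xJ x j ℚ.≤ qJ j)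

  IsRelaxedUnsplit : Assignment → Set
  IsRelaxedUnsplit x = IsUnsplit x
    × (∀ m j → Pos x j m →
         (∀ j' → Pos x j' m → rankM m j' ℕ.≤ rankM m j) →
         xM x m - qJ j ℚ.< qM m)

  better : Assignment → Fin nM → Fin nJ → ℚ
  better x m j = sumFin nJ (λ j' → if rankM m j' <ᵇ rankM m j then x j' m else 0ℚ)

  IsStable : Assignment → Set
  IsStable x = IsRelaxedUnsplit x
    × (∀ j m → adj j m ≡ true → x j m ≡ 0ℚ →
         (∃ λ m' → Pos x j m' × rankJ j m' ℕ.< rankJ j m)
         ⊎ (qM m ℚ.≤ better x m j))

  size : Assignment → ℚ
  size x = sumFin nJ (λ j → sumFin nM (λ m → notDummy m (x j m)))
    where
      notDummy : Fin nM → ℚ → ℚ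
      notDummy m v with m ≟ md
      ... | yes _ = 0ℚ
      ... | no  _ = v

  JobWP : Assignment → Assignment → Fin nJ → Set
  JobWP x1 x2 j = ∀ m2 → Pos x2 j m2 →
    ∃ λ m1 → Pos x1 j m1 × rankJ j m1 ℕ.≤ rankJ j m2

  Differ : Assignment → Assignment → Fin nJ → Fin nM → Set
  Differ x1 x2 j m = (Pos x1 j m × ¬ Pos x2 j m) ⊎ (¬ Pos x1 j m × Pos x2 j m)

  MachineWP : Assignment → Assignment → Fin nM → Set
  MachineWP x1 x2 m =
    (∀ j → adj j m ≡ true → ¬ Differ x1 x2 j m)
    ⊎ (∃ λ j → adj j m ≡ true × Differ x1 x2 j m
         × (∀ j' → adj j' m ≡ true → Differ x1 x2 j' m → rankM m j ℕ.≤ rankM m j')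
         × Pos x1 j m)

  JobOptimal : Assignment → Set
  JobOptimal x = IsStable x × (∀ y → IsStable y → ∀ j → JobWP x y j)

  MachineOptimal : Assignment → Set
  MachineOptimal x = IsStable x × (∀ y → IsStable y → ∀ m → MachineWP x y m)

-- A job placed on a real machine in x is placed on a real machine in every assignment it
-- weakly prefers to x, so |x| ≤ |y| whenever every job weakly prefers y to x.  This gives the
-- upper bound at once; for the lower bound, xmopt is shown to be job-pessimal.
-- Start from the choice sending every job to the dummy machine and repeatedly move each job to
-- its favourite machine that has room for it, counting only the jobs that the machine prefers
-- and that would accept it.  No stable assignment puts a job below its current choice, and the
-- choices improve until they reach a fixed point t.  The assignment induced by t is stable, and
-- wherever it differs from xmopt at a machine, the machine's best differing edge is its own edge,
-- not xmopt's; machine optimality therefore forces xmopt to agree with t.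

{-# OPTIONS --safe #-}
module Submission where

open import Defs
open import Data.Rational using (_≤_)
open import Data.Product using (_×_)
open import Data.Product using (∃; _,_; proj₁; proj₂)

open import Data.Bool as Bool using (true; false; if_then_else_)
open import Data.Empty using (⊥-elim)
open import Data.Fin as Fin using (Fin; zero; suc; _≟_)
import Data.Fin.Properties as Fin
open import Data.List using (filter; allFin)
open import Data.List.Extrema.Nat using (argmin; argmax; argmin-all; argmax-all; f[argmin]≤f[xs]; f[xs]≤f[argmax])
open import Data.List.Membership.Propositional.Properties using (∈-filter⁺; ∈-allFin)
import Data.List.Relation.Unary.All as All
open import Data.List.Relation.Unary.All.Properties using (all-filter)
open import Data.Nat as ℕ using (ℕ; zero; suc; _<ᵇ_)
import Data.Nat.Properties as ℕ
open import Data.Nat.Induction using (<-wellFounded)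
open import Data.Rational using (ℚ; 0ℚ; _+_; _-_; _<_; -_; _<?_)
open import Data.Rational.Properties hiding (_≟_)
open import Data.Sum using (_⊎_; inj₁; inj₂)
open import Function using (_∘_)
open import Induction.WellFounded using (Acc; acc)
open import Relation.Binary.PropositionalEquality
open import Relation.Nullary using (¬_; Dec; yes; no; does; contradiction)
open import Relation.Nullary.Decidable using (_×-dec_; ¬?; dec-true; dec-false)
open import Relation.Nullary.Reflects using (ofʸ)
open import Relation.Unary using (Decidable)
open import Algebra.Bundles using (CommutativeMonoid)
import Algebra.Properties.CommutativeSemigroup as CommutativeSemigroupProperties

p+q-q≡p : ∀ p q → p + q - q ≡ p
p+q-q≡p p q = begin
  p + q - q     ≡⟨ +-assoc p q (- q) ⟩
  p + (q - q)   ≡⟨ cong (p +_) (+-inverseʳ q) ⟩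
  p + 0ℚ        ≡⟨ +-identityʳ p ⟩
  p             ∎
  where open ≡-Reasoning

p+q≤r⇒p≤r-q : ∀ {p q r} → p + q ≤ r → p ≤ r - q
p+q≤r⇒p≤r-q {p} {q} p+q≤r = subst (_≤ _) (p+q-q≡p p q) (+-monoˡ-≤ (- q) p+q≤r)

p≤q+r⇒p-r≤q : ∀ {p q r} → p ≤ q + r → p - r ≤ q
p≤q+r⇒p-r≤q {p} {q} {r} p≤q+r = subst (_ ≤_) (p+q-q≡p q r) (+-monoˡ-≤ (- r) p≤q+r)

sumFin-0 : ∀ n → sumFin n (λ _ → 0ℚ) ≡ 0ℚ
sumFin-0 zero    = refl
sumFin-0 (suc n) = trans (+-identityˡ _) (sumFin-0 n)

sumFin-mono : ∀ n {f g : Fin n → ℚ} → (∀ i → f i ≤ g i) → sumFin n f ≤ sumFin n g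
sumFin-mono zero    _   = ≤-refl
sumFin-mono (suc n) f≤g = +-mono-≤ (f≤g zero) (sumFin-mono n (f≤g ∘ suc))

sumFin-nonneg : ∀ n {f : Fin n → ℚ} → (∀ i → 0ℚ ≤ f i) → 0ℚ ≤ sumFin n f
sumFin-nonneg n {f} f≥0 = subst (_≤ sumFin n f) (sumFin-0 n) (sumFin-mono n f≥0)

sumFin-nonpos : ∀ n {f : Fin n → ℚ} → (∀ i → f i ≤ 0ℚ) → sumFin n f ≤ 0ℚ
sumFin-nonpos n {f} f≤0 = subst (sumFin n f ≤_) (sumFin-0 n) (sumFin-mono n f≤0)

-- The values at a are moved across so that no subtraction is needed.
sumFin-mono-except : ∀ n {f g : Fin n → ℚ} a → (∀ i → i ≢ a → f i ≤ g i) →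
                     sumFin n f + g a ≤ sumFin n g + f a
sumFin-mono-except (suc n) {f} {g} zero f≤g = begin
  f zero + sumFin n (f ∘ suc) + g zero  ≡⟨ xy∙z≈zy∙x (f zero) _ (g zero) ⟩
  g zero + sumFin n (f ∘ suc) + f zero  ≤⟨ +-monoˡ-≤ (f zero) (+-monoʳ-≤ (g zero) rest) ⟩
  g zero + sumFin n (g ∘ suc) + f zero  ∎
  where
  open ≤-Reasoning
  open CommutativeSemigroupProperties (CommutativeMonoid.commutativeSemigroup +-0-commutativeMonoid)
  rest : sumFin n (f ∘ suc) ≤ sumFin n (g ∘ suc)
  rest = sumFin-mono n (λ i → f≤g (suc i) λ ())
sumFin-mono-except (suc n) {f} {g} (suc a) f≤g = begin
  f zero + sumFin n (f ∘ suc) + g (suc a)    ≡⟨ +-assoc (f zero) _ _ ⟩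
  f zero + (sumFin n (f ∘ suc) + g (suc a))  ≤⟨ +-mono-≤ (f≤g zero λ ()) rest ⟩
  g zero + (sumFin n (g ∘ suc) + f (suc a))  ≡⟨ +-assoc (g zero) _ _ ⟨
  g zero + sumFin n (g ∘ suc) + f (suc a)    ∎
  where
  open ≤-Reasoning
  rest : sumFin n (f ∘ suc) + g (suc a) ≤ sumFin n (g ∘ suc) + f (suc a)
  rest = sumFin-mono-except n a (λ i i≢a → f≤g (suc i) (i≢a ∘ Fin.suc-injective))

sumFin-single : ∀ n {f : Fin n → ℚ} → (∀ i → 0ℚ ≤ f i) → ∀ a → f a ≤ sumFin n f
sumFin-single n {f} f≥0 a = begin
  f a                           ≡⟨ +-identityˡ (f a) ⟨
  0ℚ + f a                      ≡⟨ cong (_+ f a) (sumFin-0 n) ⟨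
  sumFin n (λ _ → 0ℚ) + f a     ≤⟨ sumFin-mono-except n a (λ i _ → f≥0 i) ⟩
  sumFin n f + 0ℚ               ≡⟨ +-identityʳ _ ⟩
  sumFin n f                    ∎
  where open ≤-Reasoning

sumFin-two : ∀ n {f : Fin n → ℚ} → (∀ i → 0ℚ ≤ f i) → ∀ {a b} → a ≢ b → f a + f b ≤ sumFin n f
sumFin-two (suc n) f≥0 {zero} {zero} a≢b = ⊥-elim (a≢b refl)
sumFin-two (suc n) {f} f≥0 {zero} {suc b} _ =
  +-monoʳ-≤ (f zero) (sumFin-single n (f≥0 ∘ suc) b)
sumFin-two (suc n) {f} f≥0 {suc a} {zero} _ =
  subst (_≤ sumFin (suc n) f) (+-comm (f zero) (f (suc a)))
        (+-monoʳ-≤ (f zero) (sumFin-single n (f≥0 ∘ suc) a))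
sumFin-two (suc n) {f} f≥0 {suc a} {suc b} a≢b =
  ≤-trans (sumFin-two n (f≥0 ∘ suc) (a≢b ∘ cong suc))
          (subst (_≤ sumFin (suc n) f) (+-identityˡ _) (+-monoˡ-≤ (sumFin n (f ∘ suc)) (f≥0 zero)))

sumℕ : ∀ n → (Fin n → ℕ) → ℕ
sumℕ zero    f = 0
sumℕ (suc n) f = f zero ℕ.+ sumℕ n (f ∘ suc)

sumℕ-mono : ∀ n {f g : Fin n → ℕ} → (∀ i → f i ℕ.≤ g i) → sumℕ n f ℕ.≤ sumℕ n g
sumℕ-mono zero    _   = ℕ.z≤n
sumℕ-mono (suc n) f≤g = ℕ.+-mono-≤ (f≤g zero) (sumℕ-mono n (f≤g ∘ suc))

sumℕ-mono-< : ∀ n {f g : Fin n → ℕ} → (∀ i → f i ℕ.≤ g i) → ∀ a → f a ℕ.< g a →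
              sumℕ n f ℕ.< sumℕ n g
sumℕ-mono-< (suc n) f≤g zero    fa<ga = ℕ.+-mono-<-≤ fa<ga (sumℕ-mono n (f≤g ∘ suc))
sumℕ-mono-< (suc n) f≤g (suc a) fa<ga = ℕ.+-mono-≤-< (f≤g zero) (sumℕ-mono-< n (f≤g ∘ suc) a fa<ga)

module _ {n} {P : Fin n → Set} (P? : Decidable P) (key : Fin n → ℕ) where

  -- The default `d` competes with the elements satisfying P.
  leastBy : Fin n → Fin n
  leastBy d = argmin key d (filter P? (allFin n))

  leastBy-sat : ∀ {d} → P d → P (leastBy d)
  leastBy-sat Pd = argmin-all key Pd (all-filter P? (allFin n))

  leastBy-least : ∀ d {k} → P k → key (leastBy d) ℕ.≤ key k
  leastBy-least d Pk = All.lookup (f[argmin]≤f[xs] d _) (∈-filter⁺ P? (∈-allFin _) Pk)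

  greatestBy : Fin n → Fin n
  greatestBy d = argmax key d (filter P? (allFin n))

  greatestBy-sat : ∀ {d} → P d → P (greatestBy d)
  greatestBy-sat Pd = argmax-all key Pd (all-filter P? (allFin n))

  greatestBy-greatest : ∀ d {k} → P k → key k ℕ.≤ key (greatestBy d)
  greatestBy-greatest d Pk = All.lookup (f[xs]≤f[argmax] d _) (∈-filter⁺ P? (∈-allFin _) Pk)

module _ {A : Set} {Inv Fixed : A → Set} (step : A → A) (potential : A → ℕ)
         (fixed? : Decidable Fixed)
         (step-inv : ∀ {a} → Inv a → Inv (step a))
         (step-decreases : ∀ {a} → Inv a → ¬ Fixed a → potential (step a) ℕ.< potential a) where

  iterate-to-fixed : ∀ {a} → Inv a → ∃ λ b → Inv b × Fixed b
  iterate-to-fixed {a} = go a (<-wellFounded (potential a))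
    where
    go : ∀ a → Acc ℕ._<_ (potential a) → Inv a → ∃ λ b → Inv b × Fixed b
    go a (acc rec) inv with fixed? a
    ... | yes fixed = a , inv , fixed
    ... | no ¬fixed = go (step a) (rec (step-decreases inv ¬fixed)) (step-inv inv)

-- `size` sums a function local to its definition; `summand` names it through unification.
summand : ∀ {n k} {f : Fin n → Fin k → ℚ} (s : ℚ) → s ≡ sumFin n (λ i → sumFin k (f i)) →
          Fin n → Fin k → ℚ
summand {f = f} _ _ = f

module _ (I : Instance) where
  open Instance I

  qJ-nonneg : ∀ j → 0ℚ ≤ qJ j
  qJ-nonneg j = <⇒≤ (qJ-pos j)

  module _ {x : Assignment I} (a : IsAssignment I x) where

    assignment-nonneg : ∀ j m → 0ℚ ≤ x j m
    assignment-nonneg = proj₁ a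

    ¬Pos⇒≡0 : ∀ {j m} → ¬ Pos I x j m → x j m ≡ 0ℚ
    ¬Pos⇒≡0 ¬p = ≤-antisym (≮⇒≥ ¬p) (assignment-nonneg _ _)

    Pos⇒adj : ∀ {j m} → Pos I x j m → adj j m ≡ true
    Pos⇒adj {j} {m} p with adj j m in e
    ... | true  = refl
    ... | false = ⊥-elim (<-irrefl (sym (proj₂ a j m e)) p)

  module _ {x : Assignment I} (u : IsUnsplit I x) where

    private
      a : IsAssignment I x
      a = proj₁ u

    Pos⇒≡qJ : ∀ {j m} → Pos I x j m → x j m ≡ qJ j
    Pos⇒≡qJ {j} {m} p with proj₁ (proj₂ u) j m (Pos⇒adj a p)
    ... | inj₁ ≡0  = ⊥-elim (<-irrefl (sym ≡0) p)
    ... | inj₂ ≡qJ = ≡qJ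

    unsplit-≤qJ : ∀ j m → x j m ≤ qJ j
    unsplit-≤qJ j m with 0ℚ <? x j m
    ... | yes p = ≤-reflexive (Pos⇒≡qJ p)
    ... | no ¬p = subst (_≤ qJ j) (sym (¬Pos⇒≡0 a ¬p)) (qJ-nonneg j)

    Pos-unique : ∀ {j m m'} → Pos I x j m → Pos I x j m' → m ≡ m'
    Pos-unique {j} {m} {m'} p p' with m ≟ m'
    ... | yes m≡m' = m≡m'
    ... | no m≢m'  = ⊥-elim (<-irrefl refl (begin-strict
      qJ j                 ≡⟨ +-identityʳ (qJ j) ⟨
      qJ j + 0ℚ            <⟨ +-monoʳ-< (qJ j) (qJ-pos j) ⟩
      qJ j + qJ j          ≡⟨ cong₂ _+_ (Pos⇒≡qJ p) (Pos⇒≡qJ p') ⟨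
      x j m + x j m'       ≤⟨ sumFin-two nM (assignment-nonneg a j) m≢m' ⟩
      xJ I x j             ≤⟨ proj₂ (proj₂ u) j ⟩
      qJ j                 ∎))
      where open ≤-Reasoning

  stable⇒unsplit : ∀ {x} → IsStable I x → IsUnsplit I x
  stable⇒unsplit = proj₁ ∘ proj₁

  preferredPart : Fin nM → Fin nJ → (Fin nJ → ℚ) → Fin nJ → ℚ
  preferredPart m j f j' = if rankM m j' <ᵇ rankM m j then f j' else 0ℚ

  preferredSum : Fin nM → Fin nJ → (Fin nJ → ℚ) → ℚ
  preferredSum m j f = sumFin nJ (preferredPart m j f)

  preferredPart-≡ : ∀ {m j j'} f → rankM m j' ℕ.< rankM m j → preferredPart m j f j' ≡ f j'
  preferredPart-≡ {j' = j'} f lt = cong (if_then f j' else 0ℚ) (dec-true (_ ℕ.<? _) lt)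

  preferredPart-≡0 : ∀ {m j j'} f → rankM m j ℕ.≤ rankM m j' → preferredPart m j f j' ≡ 0ℚ
  preferredPart-≡0 {j' = j'} f ge = cong (if_then f j' else 0ℚ) (dec-false (_ ℕ.<? _) (ℕ.≤⇒≯ ge))

  preferredPart-≤ : ∀ {m j j'} f → 0ℚ ≤ f j' → preferredPart m j f j' ≤ f j'
  preferredPart-≤ {m} {j} {j'} f f≥0 with rankM m j' <ᵇ rankM m j
  ... | true  = ≤-refl
  ... | false = f≥0

  preferredPart-nonneg : ∀ {m j j'} f → 0ℚ ≤ f j' → 0ℚ ≤ preferredPart m j f j'
  preferredPart-nonneg {m} {j} {j'} f f≥0 with rankM m j' <ᵇ rankM m j
  ... | true  = f≥0
  ... | false = ≤-refl

  preferredSum-mono : ∀ {m j f g} → (∀ j' → rankM m j' ℕ.< rankM m j → f j' ≤ g j') →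
                      preferredSum m j f ≤ preferredSum m j g
  preferredSum-mono {m} {j} {f} {g} f≤g = sumFin-mono nJ term
    where
    term : ∀ j' → preferredPart m j f j' ≤ preferredPart m j g j'
    term j' with rankM m j' <ᵇ rankM m j | ℕ.<ᵇ-reflects-< (rankM m j') (rankM m j)
    ... | true  | ofʸ lt = f≤g j' lt
    ... | false | _      = ≤-refl

  preferredSum-threshold : ∀ {m j₁ j₂ f} → rankM m j₁ ℕ.≤ rankM m j₂ → (∀ j' → 0ℚ ≤ f j') →
                           preferredSum m j₁ f ≤ preferredSum m j₂ f
  preferredSum-threshold {m} {j₁} {j₂} {f} le f≥0 = sumFin-mono nJ term
    where
    term : ∀ j' → preferredPart m j₁ f j' ≤ preferredPart m j₂ f j'
    term j' with rankM m j' <ᵇ rankM m j₁ | ℕ.<ᵇ-reflects-< (rankM m j') (rankM m j₁)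
    ... | true  | ofʸ lt = ≤-reflexive (sym (preferredPart-≡ f (ℕ.<-≤-trans lt le)))
    ... | false | _      with rankM m j' <ᵇ rankM m j₂
    ...   | true  = f≥0 j'
    ...   | false = ≤-refl

  preferredSum≤sumFin : ∀ {m j f g} → (∀ j' → f j' ≤ g j') → (∀ j' → 0ℚ ≤ g j') →
                        preferredSum m j f ≤ sumFin nJ g
  preferredSum≤sumFin {m} {j} {f} {g} f≤g g≥0 = sumFin-mono nJ term
    where
    term : ∀ j' → preferredPart m j f j' ≤ g j'
    term j' with rankM m j' <ᵇ rankM m j
    ... | true  = f≤g j'
    ... | false = g≥0 j'

  -- Apply the relaxation at the job `last` that m likes least: it is not counted in `better I x m j`.
  better<qM : ∀ {x} → IsRelaxedUnsplit I x → ∀ {j m} → Pos I x j m → better I x m j < qM m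
  better<qM {x} (u , relaxed) {j} {m} p = ≤-<-trans better≤ (relaxed m last last-Pos last-least)
    where
    assigned? : Decidable (λ k → Pos I x k m)
    assigned? k = 0ℚ <? x k m
    last : Fin nJ
    last = greatestBy assigned? (rankM m) j
    last-Pos : Pos I x last m
    last-Pos = greatestBy-sat assigned? (rankM m) p
    last-least : ∀ k → Pos I x k m → rankM m k ℕ.≤ rankM m last
    last-least k = greatestBy-greatest assigned? (rankM m) j
    column : Fin nJ → ℚ
    column k = x k m
    column≥0 : ∀ k → 0ℚ ≤ column k
    column≥0 k = assignment-nonneg (proj₁ u) k m
    better≤ : better I x m j ≤ xM I x m - qJ last
    better≤ = p+q≤r⇒p≤r-q (begin
      preferredSum m j column + qJ last       ≡⟨ cong (preferredSum m j column +_) (Pos⇒≡qJ u last-Pos) ⟨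
      preferredSum m j column + column last
        ≤⟨ sumFin-mono-except nJ last (λ k _ → preferredPart-≤ column (column≥0 k)) ⟩
      sumFin nJ column + preferredPart m j column last
        ≡⟨ cong (sumFin nJ column +_) (preferredPart-≡0 column (last-least j p)) ⟩
      sumFin nJ column + 0ℚ                   ≡⟨ +-identityʳ _ ⟩
      sumFin nJ column                        ∎)
      where open ≤-Reasoning

  stable-unassigned : ∀ {x} → IsStable I x → ∀ {j m} → adj j m ≡ true → ¬ Pos I x j m →
                      (∃ λ m' → Pos I x j m' × rankJ j m' ℕ.< rankJ j m) ⊎ (qM m ≤ better I x m j)
  stable-unassigned ((u , _) , stable) adjjm ¬p = stable _ _ adjjm (¬Pos⇒≡0 (proj₁ u) ¬p)

  stable⇒assigned : ∀ {x} → IsStable I x → ∀ j → ∃ λ m → Pos I x j m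
  stable⇒assigned {x} st@((u , _) , _) j with Fin.any? (λ m → 0ℚ <? x j m)
  ... | yes assigned = assigned
  ... | no ¬assigned with stable-unassigned st (md-adj j) (λ p → ¬assigned (md , p))
  ...   | inj₁ (m , p , _) = ⊥-elim (¬assigned (m , p))
  ...   | inj₂ full        = ⊥-elim (<-irrefl refl (begin-strict
    qM md               ≤⟨ full ⟩
    better I x md j     ≤⟨ preferredSum≤sumFin (λ k → unsplit-≤qJ u k md) qJ-nonneg ⟩
    sumFin nJ qJ        <⟨ md-cap ⟩
    qM md               ∎))
    where open ≤-Reasoning

  Choice : Set
  Choice = Fin nJ → Fin nM

  Accepts : Choice → Fin nJ → Fin nM → Set
  Accepts t j m = adj j m ≡ true × rankJ j m ℕ.≤ rankJ j (t j)

  accepts? : ∀ t j m → Dec (Accepts t j m)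
  accepts? t j m = (adj j m Bool.≟ true) ×-dec (rankJ j m ℕ.≤? rankJ j (t j))

  offer : Choice → Fin nM → Fin nJ → ℚ
  offer t m j = if does (accepts? t j m) then qJ j else 0ℚ

  offer-nonneg : ∀ t m j → 0ℚ ≤ offer t m j
  offer-nonneg t m j with does (accepts? t j m)
  ... | true  = qJ-nonneg j
  ... | false = ≤-refl

  offer-≤qJ : ∀ t m j → offer t m j ≤ qJ j
  offer-≤qJ t m j with does (accepts? t j m)
  ... | true  = ≤-refl
  ... | false = qJ-nonneg j

  offer-≡qJ : ∀ t {j m} → Accepts t j m → offer t m j ≡ qJ j
  offer-≡qJ t {j} {m} accepts = cong (if_then qJ j else 0ℚ) (dec-true (accepts? t j m) accepts)

  offer-≡0 : ∀ t {j m} → ¬ Accepts t j m → offer t m j ≡ 0ℚ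
  offer-≡0 t {j} {m} ¬accepts = cong (if_then qJ j else 0ℚ) (dec-false (accepts? t j m) ¬accepts)

  load : Choice → Fin nM → Fin nJ → ℚ
  load t m j = preferredSum m j (offer t m)

  HasRoom : Choice → Fin nM → Fin nJ → Set
  HasRoom t m j = Accepts t j m × load t m j < qM m

  hasRoom? : ∀ t m j → Dec (HasRoom t m j)
  hasRoom? t m j = accepts? t j m ×-dec (load t m j <? qM m)

  improve : Choice → Choice
  improve t j = leastBy (λ m → hasRoom? t m j) (rankJ j) (t j)

  Feasible : Choice → Set
  Feasible t = ∀ j → HasRoom t (t j) j

  Fixed : Choice → Set
  Fixed t = ∀ j → improve t j ≡ t j

  Dominates : Choice → Choice → Set
  Dominates t' t = ∀ j → rankJ j (t' j) ℕ.≤ rankJ j (t j)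

  LowerBound : Choice → Assignment I → Set
  LowerBound t x = ∀ j m → Pos I x j m → rankJ j m ℕ.≤ rankJ j (t j)

  improve-hasRoom : ∀ {t} → Feasible t → ∀ j → HasRoom t (improve t j) j
  improve-hasRoom {t} feasible j = leastBy-sat (λ m → hasRoom? t m j) (rankJ j) (feasible j)

  improve-best : ∀ {t j m} → HasRoom t m j → rankJ j (improve t j) ℕ.≤ rankJ j m
  improve-best {t} {j} = leastBy-least (λ m → hasRoom? t m j) (rankJ j) (t j)

  improve-dominates : ∀ {t} → Feasible t → Dominates (improve t) t
  improve-dominates feasible j = improve-best (feasible j)

  load-anti : ∀ {t' t} → Dominates t' t → ∀ m j → load t' m j ≤ load t m j
  load-anti {t'} {t} dominates m j = preferredSum-mono (λ k _ → offer-anti k)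
    where
    offer-anti : ∀ k → offer t' m k ≤ offer t m k
    offer-anti k with accepts? t' k m
    ... | yes (adjacent , m≤t'k) = ≤-reflexive (trans (offer-≡qJ t' (adjacent , m≤t'k))
                                                      (sym (offer-≡qJ t (adjacent , ℕ.≤-trans m≤t'k (dominates k)))))
    ... | no ¬accepts            = subst (_≤ offer t m k) (sym (offer-≡0 t' ¬accepts)) (offer-nonneg t m k)

  improve-feasible : ∀ {t} → Feasible t → Feasible (improve t)
  improve-feasible {t} feasible j =
    (proj₁ (proj₁ (improve-hasRoom feasible j)) , ℕ.≤-refl) ,
    ≤-<-trans (load-anti (improve-dominates feasible) (improve t j) j) (proj₂ (improve-hasRoom feasible j))

  potential : Choice → ℕ
  potential t = sumℕ nJ (λ j → rankJ j (t j))

  fixed? : Decidable Fixed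
  fixed? t = Fin.all? (λ j → improve t j ≟ t j)

  improve-decreases : ∀ {t} → Feasible t → ¬ Fixed t → potential (improve t) ℕ.< potential t
  improve-decreases {t} feasible ¬fixed with Fin.¬∀⟶∃¬ nJ _ (λ j → improve t j ≟ t j) ¬fixed
  ... | j , moved = sumℕ-mono-< nJ (improve-dominates feasible) j
                      (ℕ.≤∧≢⇒< (improve-dominates feasible j) (moved ∘ rankJ-inj j _ _ adjacent adjacent'))
    where
    adjacent : adj j (improve t j) ≡ true
    adjacent = proj₁ (proj₁ (improve-hasRoom feasible j))
    adjacent' : adj j (t j) ≡ true
    adjacent' = proj₁ (proj₁ (feasible j))

  LowerBound⇒≤offer : ∀ {x t} → IsUnsplit I x → LowerBound t x → ∀ k m → x k m ≤ offer t m k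
  LowerBound⇒≤offer {x} {t} u below k m with 0ℚ <? x k m
  ... | yes p = ≤-reflexive (trans (Pos⇒≡qJ u p) (sym (offer-≡qJ t (Pos⇒adj (proj₁ u) p , below k m p))))
  ... | no ¬p = subst (_≤ offer t m k) (sym (¬Pos⇒≡0 (proj₁ u) ¬p)) (offer-nonneg t m k)

  -- Otherwise j and its machine under improve t would block x.
  improve-lowerBound : ∀ {x t} → IsStable I x → Feasible t → LowerBound t x → LowerBound (improve t) x
  improve-lowerBound {x} {t} st feasible below j m p = ℕ.≮⇒≥ not-above
    where
    u : IsUnsplit I x
    u = stable⇒unsplit st
    m₀ : Fin nM
    m₀ = improve t j
    not-above : ¬ rankJ j m₀ ℕ.< rankJ j m
    not-above m₀<m with stable-unassigned st (proj₁ (proj₁ (improve-hasRoom feasible j)))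
                          (λ p₀ → ℕ.<-irrefl (cong (rankJ j) (Pos-unique u p₀ p)) m₀<m)
    ... | inj₁ (m' , p' , m'<m₀) = ℕ.<-irrefl (cong (rankJ j) (Pos-unique u p' p)) (ℕ.<-trans m'<m₀ m₀<m)
    ... | inj₂ full = <-irrefl refl (begin-strict
      qM m₀              ≤⟨ full ⟩
      better I x m₀ j    ≤⟨ preferredSum-mono (λ k _ → LowerBound⇒≤offer u below k m₀) ⟩
      load t m₀ j        <⟨ proj₂ (improve-hasRoom feasible j) ⟩
      qM m₀              ∎)
      where open ≤-Reasoning

  allDummy : Choice
  allDummy _ = md

  allDummy-feasible : Feasible allDummy
  allDummy-feasible j =
    (md-adj j , ℕ.≤-refl) , ≤-<-trans (preferredSum≤sumFin (offer-≤qJ allDummy md) qJ-nonneg) md-cap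

  allDummy-lowerBound : ∀ {x} → IsAssignment I x → LowerBound allDummy x
  allDummy-lowerBound a j m p with m ≟ md
  ... | yes refl  = ℕ.≤-refl
  ... | no m≢md   = ℕ.<⇒≤ (md-last j m (Pos⇒adj a p) m≢md)

  StableLowerBound : Choice → Set
  StableLowerBound t = ∀ {x} → IsStable I x → LowerBound t x

  pessimalChoice : ∃ λ t → (Feasible t × StableLowerBound t) × Fixed t
  pessimalChoice = iterate-to-fixed improve potential fixed?
    (λ (feasible , below) → improve-feasible feasible , λ {x} st → improve-lowerBound st feasible (below st))
    (improve-decreases ∘ proj₁)
    (allDummy-feasible , λ {x} st → allDummy-lowerBound (proj₁ (stable⇒unsplit st)))

  assign : Choice → Assignment I
  assign t j m = if does (m ≟ t j) then qJ j else 0ℚ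

  assign-chosen : ∀ t j → assign t j (t j) ≡ qJ j
  assign-chosen t j = cong (if_then qJ j else 0ℚ) (dec-true (t j ≟ t j) refl)

  assign-other : ∀ t {j m} → m ≢ t j → assign t j m ≡ 0ℚ
  assign-other t {j} {m} m≢tj = cong (if_then qJ j else 0ℚ) (dec-false (m ≟ t j) m≢tj)

  assign-nonneg : ∀ t j m → 0ℚ ≤ assign t j m
  assign-nonneg t j m with does (m ≟ t j)
  ... | true  = qJ-nonneg j
  ... | false = ≤-refl

  assign-Pos : ∀ t j → Pos I (assign t) j (t j)
  assign-Pos t j = subst (0ℚ <_) (sym (assign-chosen t j)) (qJ-pos j)

  Pos-assign⇒chosen : ∀ t {j m} → Pos I (assign t) j m → t j ≡ m
  Pos-assign⇒chosen t {j} {m} p with m ≟ t j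
  ... | yes m≡tj = sym m≡tj
  ... | no _     = ⊥-elim (<-irrefl refl p)

  assign-unsplit : ∀ t → (∀ j → adj j (t j) ≡ true) → IsUnsplit I (assign t)
  assign-unsplit t adjacent = (assign-nonneg t , nonadjacent) , zero-or-qJ , row≤qJ
    where
    nonadjacent : ∀ j m → adj j m ≡ false → assign t j m ≡ 0ℚ
    nonadjacent j m e with m ≟ t j
    ... | yes refl = contradiction (trans (sym (adjacent j)) e) λ ()
    ... | no _     = refl
    zero-or-qJ : ∀ j m → adj j m ≡ true → (assign t j m ≡ 0ℚ) ⊎ (assign t j m ≡ qJ j)
    zero-or-qJ j m _ with does (m ≟ t j)
    ... | true  = inj₂ refl
    ... | false = inj₁ refl
    row≤qJ : ∀ j → xJ I (assign t) j ≤ qJ j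
    row≤qJ j = begin
      xJ I (assign t) j                         ≡⟨ +-identityʳ _ ⟨
      xJ I (assign t) j + 0ℚ
        ≤⟨ sumFin-mono-except nM (t j) (λ m m≢tj → ≤-reflexive (assign-other t m≢tj)) ⟩
      sumFin nM (λ _ → 0ℚ) + assign t j (t j)   ≡⟨ cong₂ _+_ (sumFin-0 nM) (assign-chosen t j) ⟩
      0ℚ + qJ j                                 ≡⟨ +-identityˡ (qJ j) ⟩
      qJ j                                      ∎
      where open ≤-Reasoning

  Differ-Pos : ∀ {x y j m} → Differ I x y j m → Pos I x j m → ¬ Pos I y j m
  Differ-Pos (inj₁ (_ , ¬py)) _  = ¬py
  Differ-Pos (inj₂ (¬px , _)) px = contradiction px ¬px

  module AtFixedPoint {t : Choice} (feasible : Feasible t) (fixed : Fixed t) where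

    chosen-accepts : ∀ j → Accepts t j (t j)
    chosen-accepts j = proj₁ (feasible j)

    hasRoom⇒chosen : ∀ {j m} → HasRoom t m j → t j ≡ m
    hasRoom⇒chosen {j} {m} room@((adjacent , m≤tj) , _) =
      rankJ-inj j (t j) m (proj₁ (chosen-accepts j)) adjacent
        (ℕ.≤-antisym (subst (λ m' → rankJ j m' ℕ.≤ rankJ j m) (fixed j) (improve-best room)) m≤tj)

    assign-isUnsplit : IsUnsplit I (assign t)
    assign-isUnsplit = assign-unsplit t (proj₁ ∘ chosen-accepts)

    assign-isAssignment : IsAssignment I (assign t)
    assign-isAssignment = proj₁ assign-isUnsplit

    -- The job `rival` that m ranks best among those accepting m but placed elsewhere found no room
    -- at m, and every job m prefers to it that accepts m is placed on m.
    full : ∀ {j m} → Accepts t j m → t j ≢ m → qM m ≤ better I (assign t) m j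
    full {j} {m} accepts tj≢m = begin
      qM m                          ≤⟨ ≮⇒≥ (λ room → proj₂ rival-sat (hasRoom⇒chosen (proj₁ rival-sat , room))) ⟩
      load t m rival                ≤⟨ preferredSum-mono offer≤assign ⟩
      better I (assign t) m rival   ≤⟨ preferredSum-threshold (rival-least (accepts , tj≢m)) (λ k → assign-nonneg t k m) ⟩
      better I (assign t) m j       ∎
      where
      open ≤-Reasoning
      Rival : Fin nJ → Set
      Rival k = Accepts t k m × t k ≢ m
      rival? : Decidable Rival
      rival? k = accepts? t k m ×-dec ¬? (t k ≟ m)
      rival : Fin nJ
      rival = leastBy rival? (rankM m) j
      rival-sat : Rival rival
      rival-sat = leastBy-sat rival? (rankM m) (accepts , tj≢m)
      rival-least : ∀ {k} → Rival k → rankM m rival ℕ.≤ rankM m k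
      rival-least = leastBy-least rival? (rankM m) j
      offer≤assign : ∀ k → rankM m k ℕ.< rankM m rival → offer t m k ≤ assign t k m
      offer≤assign k k<rival with accepts? t k m | t k ≟ m
      ... | no ¬accepts  | _        = subst (_≤ assign t k m) (sym (offer-≡0 t ¬accepts)) (assign-nonneg t k m)
      ... | yes accepts′ | yes refl = ≤-reflexive (trans (offer-≡qJ t accepts′) (sym (assign-chosen t k)))
      ... | yes accepts′ | no tk≢m  = ⊥-elim (ℕ.<⇒≱ k<rival (rival-least (accepts′ , tk≢m)))

    assign-relaxed : IsRelaxedUnsplit I (assign t)
    assign-relaxed = assign-isUnsplit , relaxed
      where
      relaxed : ∀ m j → Pos I (assign t) j m →
                (∀ j' → Pos I (assign t) j' m → rankM m j' ℕ.≤ rankM m j) →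
                xM I (assign t) m - qJ j < qM m
      relaxed m j p least = ≤-<-trans (p≤q+r⇒p-r≤q column≤) room
        where
        open ≤-Reasoning
        room : load t m j < qM m
        room = subst (λ m' → load t m' j < qM m') (Pos-assign⇒chosen t p) (proj₂ (feasible j))
        others : ∀ k → k ≢ j → assign t k m ≤ preferredPart m j (offer t m) k
        others k k≢j with 0ℚ <? assign t k m
        ... | no ¬pk = subst (_≤ preferredPart m j (offer t m) k)
                             (sym (¬Pos⇒≡0 assign-isAssignment {k} {m} ¬pk))
                             (preferredPart-nonneg (offer t m) (offer-nonneg t m k))
        ... | yes pk = begin
          assign t k m                      ≡⟨ Pos⇒≡qJ assign-isUnsplit {k} {m} pk ⟩
          qJ k
            ≡⟨ offer-≡qJ t (subst (Accepts t k) (Pos-assign⇒chosen t pk) (chosen-accepts k)) ⟨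
          offer t m k                       ≡⟨ preferredPart-≡ (offer t m) k<j ⟨
          preferredPart m j (offer t m) k   ∎
          where
          k<j : rankM m k ℕ.< rankM m j
          k<j = ℕ.≤∧≢⇒< (least k pk)
                  (k≢j ∘ rankM-inj m k j (Pos⇒adj assign-isAssignment {k} pk) (Pos⇒adj assign-isAssignment {j} p))
        column≤ : xM I (assign t) m ≤ load t m j + qJ j
        column≤ = begin
          xM I (assign t) m                                     ≡⟨ +-identityʳ _ ⟨
          xM I (assign t) m + 0ℚ
            ≡⟨ cong (xM I (assign t) m +_) (preferredPart-≡0 (offer t m) ℕ.≤-refl) ⟨
          xM I (assign t) m + preferredPart m j (offer t m) j   ≤⟨ sumFin-mono-except nJ j others ⟩
          load t m j + assign t j m
            ≡⟨ cong (load t m j +_) (Pos⇒≡qJ assign-isUnsplit {j} {m} p) ⟩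
          load t m j + qJ j                                     ∎

    assign-stable : IsStable I (assign t)
    assign-stable = assign-relaxed , stable
      where
      stable : ∀ j m → adj j m ≡ true → assign t j m ≡ 0ℚ →
               (∃ λ m' → Pos I (assign t) j m' × rankJ j m' ℕ.< rankJ j m) ⊎
               (qM m ≤ better I (assign t) m j)
      stable j m adjacent ≡0 with rankJ j (t j) ℕ.<? rankJ j m
      ... | yes tj<m = inj₁ (t j , assign-Pos t j , tj<m)
      ... | no tj≮m  = inj₂ (full (adjacent , ℕ.≮⇒≥ tj≮m) tj≢m)
        where
        tj≢m : t j ≢ m
        tj≢m tj≡m = <-irrefl (sym ≡0) (subst (Pos I (assign t) j) tj≡m (assign-Pos t j))

    -- Otherwise m is full under assign t with jobs it prefers to j₀, all of which y keeps on m.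
    bestDifference-¬Pos : ∀ {y m j₀} → IsRelaxedUnsplit I y → LowerBound t y → adj j₀ m ≡ true →
                          Differ I y (assign t) j₀ m →
                          (∀ k → adj k m ≡ true → Differ I y (assign t) k m → rankM m j₀ ℕ.≤ rankM m k) →
                          ¬ Pos I y j₀ m
    bestDifference-¬Pos {y} {m} {j₀} relaxed below adjacent differ best p₀ = <-irrefl refl (begin-strict
      qM m                       ≤⟨ full (adjacent , below j₀ m p₀) tj₀≢m ⟩
      better I (assign t) m j₀   ≤⟨ preferredSum-mono assign≤y ⟩
      better I y m j₀            <⟨ better<qM relaxed p₀ ⟩
      qM m                       ∎)
      where
      open ≤-Reasoning
      uy : IsUnsplit I y
      uy = proj₁ relaxed
      tj₀≢m : t j₀ ≢ m
      tj₀≢m tj₀≡m = Differ-Pos {y} {assign t} differ p₀ (subst (Pos I (assign t) j₀) tj₀≡m (assign-Pos t j₀))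
      assign≤y : ∀ k → rankM m k ℕ.< rankM m j₀ → assign t k m ≤ y k m
      assign≤y k k<j₀ with 0ℚ <? assign t k m
      ... | no ¬pa = subst (_≤ y k m) (sym (¬Pos⇒≡0 assign-isAssignment {k} {m} ¬pa))
                           (assignment-nonneg (proj₁ uy) k m)
      ... | yes pa with 0ℚ <? y k m
      ...   | yes py = ≤-reflexive (trans (Pos⇒≡qJ assign-isUnsplit {k} {m} pa) (sym (Pos⇒≡qJ uy py)))
      ...   | no ¬py = ⊥-elim (ℕ.<⇒≱ k<j₀ (best k (Pos⇒adj assign-isAssignment {k} pa) (inj₂ (¬py , pa))))

    machineOptimal⇒chosen : ∀ {xm} → MachineOptimal I xm → LowerBound t xm →
                            ∀ {j m} → Pos I xm j m → t j ≡ m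
    machineOptimal⇒chosen ((relaxed , _) , optimal) below {j} {m} p with optimal (assign t) assign-stable m
    ... | inj₂ (j₀ , adjacent , differ , best , p₀) =
      ⊥-elim (bestDifference-¬Pos relaxed below adjacent differ best p₀)
    ... | inj₁ noDifference with t j ≟ m
    ...   | yes tj≡m = tj≡m
    ...   | no tj≢m  =
      ⊥-elim (noDifference j (Pos⇒adj (proj₁ (proj₁ relaxed)) p) (inj₁ (p , tj≢m ∘ Pos-assign⇒chosen t)))

  machineOptimal⇒jobPessimal : ∀ {xm x} → MachineOptimal I xm → IsStable I x → ∀ j → JobWP I x xm j
  machineOptimal⇒jobPessimal mo st j m p =
    let _ , (feasible , below) , fixed = pessimalChoice
        m' , p' = stable⇒assigned st j
        tj≡m = AtFixedPoint.machineOptimal⇒chosen feasible fixed mo (below (proj₁ mo)) p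
    in m' , p' , subst (λ m'' → rankJ j m' ℕ.≤ rankJ j m'') tj≡m (below st j m' p')

  Placed : Assignment I → Fin nJ → Set
  Placed x j = ∃ λ m → m ≢ md × Pos I x j m

  placed? : ∀ x j → Dec (Placed x j)
  placed? x j = Fin.any? (λ m → ¬? (m ≟ md) ×-dec (0ℚ <? x j m))

  JobWP⇒Placed : ∀ {x y j} → IsAssignment I x → JobWP I y x j → Placed x j → Placed y j
  JobWP⇒Placed {j = j} a prefers (m , m≢md , p) with prefers m p
  ... | m' , p' , m'≤m = m' , m'≢md , p'
    where
    m'≢md : m' ≢ md
    m'≢md m'≡md = ℕ.<⇒≱ (md-last j m (Pos⇒adj a p) m≢md) (subst (λ m'' → rankJ j m'' ℕ.≤ rankJ j m) m'≡md m'≤m)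

  sizeTerm : Assignment I → Fin nJ → Fin nM → ℚ
  sizeTerm x = summand (size I x) refl

  jobSize : Assignment I → Fin nJ → ℚ
  jobSize x j = sumFin nM (sizeTerm x j)

  module _ {x : Assignment I} (u : IsUnsplit I x) (j : Fin nJ) where

    private
      a : IsAssignment I x
      a = proj₁ u

    sizeTerm-nonneg : ∀ m → 0ℚ ≤ sizeTerm x j m
    sizeTerm-nonneg m with m ≟ md
    ... | yes _ = ≤-refl
    ... | no _  = assignment-nonneg a j m

    jobSize-≤qJ : jobSize x j ≤ qJ j
    jobSize-≤qJ = ≤-trans (sumFin-mono nM term) (proj₂ (proj₂ u) j)
      where
      term : ∀ m → sizeTerm x j m ≤ x j m
      term m with m ≟ md
      ... | yes _ = assignment-nonneg a j m
      ... | no _  = ≤-refl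

    qJ≤jobSize : Placed x j → qJ j ≤ jobSize x j
    qJ≤jobSize (m , m≢md , p) =
      ≤-trans (≤-reflexive (sym (trans term (Pos⇒≡qJ u p)))) (sumFin-single nM sizeTerm-nonneg m)
      where
      term : sizeTerm x j m ≡ x j m
      term with m ≟ md
      ... | yes m≡md = contradiction m≡md m≢md
      ... | no _     = refl

    jobSize-unplaced : ¬ Placed x j → jobSize x j ≤ 0ℚ
    jobSize-unplaced ¬placed = sumFin-nonpos nM term
      where
      term : ∀ m → sizeTerm x j m ≤ 0ℚ
      term m with m ≟ md
      ... | yes _   = ≤-refl
      ... | no m≢md = ≤-reflexive (¬Pos⇒≡0 a (λ p → ¬placed (m , m≢md , p)))

  jobSize-mono : ∀ {x y} → IsUnsplit I x → IsUnsplit I y → ∀ j → (Placed x j → Placed y j) →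
                 jobSize x j ≤ jobSize y j
  jobSize-mono {x} ux uy j placed with placed? x j
  ... | yes px  = ≤-trans (jobSize-≤qJ ux j) (qJ≤jobSize uy j (placed px))
  ... | no ¬px  = ≤-trans (jobSize-unplaced ux j ¬px) (sumFin-nonneg nM (sizeTerm-nonneg uy j))

  JobWP⇒size≤ : ∀ {x y} → IsUnsplit I x → IsUnsplit I y → (∀ j → JobWP I y x j) → size I x ≤ size I y
  JobWP⇒size≤ {x} {y} ux uy prefers =
    sumFin-mono nJ (λ j → jobSize-mono ux uy j (JobWP⇒Placed {y = y} (proj₁ ux) (prefers j)))

theorem1 : (I : Instance) (xjopt xmopt x : Assignment I) →
    JobOptimal I xjopt → MachineOptimal I xmopt → IsStable I x →
    (size I xmopt ≤ size I x) × (size I x ≤ size I xjopt)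
theorem1 I xjopt xmopt x (stable-jopt , jopt-best) mopt stable =
  JobWP⇒size≤ I (stable⇒unsplit I (proj₁ mopt)) (stable⇒unsplit I stable)
                (machineOptimal⇒jobPessimal I mopt stable) ,
  JobWP⇒size≤ I (stable⇒unsplit I stable) (stable⇒unsplit I stable-jopt) (jopt-best x stable)
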